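{- Let $T$ be a total pivoted caterpillar. Then $T$ is either a total pivoted caterpillar of type 1 or a total pivoted caterpillar of type 2, but not both.
   Context: A caterpillar is a tree $T$ with a central path $\mathcal{P}$ (the path formed by its non-leaf vertices) such that every leaf is at distance one from $\mathcal{P}$. For a simple graph: elements are vertices and edges; two elements are adjacent if they are adjacent vertices, a vertex and an incident edge, or two distinct edges sharing an endpoint; $d_t(x)$ is the number of elements adjacent to $x$. With elements ordered by non-increasing total degree $d_t(x_1)\ge d_t(x_2)\ge\cdots$, $m_t(G)=\max\{i:d_t(x_i)\ge i-1\}$. With $m=m_t(G)$, an element $x$ is total dense if $d_t(x)\ge m-1$. A path $\langle w_1,\dots,w_k\rangle$ is a total dense path if $w_2,\dots,w_{k-1}$ are total dense and every edge $(w_i,w_{i+1})$ is total dense; its length $\ell$ is its number of edges. Two paths are adjacent if the last vertex of one equals the first vertex of the other. A caterpillar $T$ with central path $\mathcal{P}$, $m=m_t(T)\ge 6$ and exactly $m$ total dense elements is total pivoted if either (1) there is a total dense vertex $u$ with $d(u)=m-2$ having a neighbour $u'$ with $d(u')=2$ that is adjacent to a total dense vertex $v\ne u$ (type 1); or (2) there are paths $P_1,P_2,Q\subseteq\mathcal{P}$ such that $P_1,P_2$ are the only total dense paths of $T$, each contains exactly three total dense elements, $Q$ has $\ell(Q)\le 1$ and no total dense element, and $Q$ is adjacent to both $P_1$ and $P_2$ (type 2). -}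

module Defs where

open import Data.Nat using (ℕ; zero; suc; _≤_; _∸_; _≤ᵇ_; _⊔_)
open import Data.Bool using (Bool; true; false; _∧_; _∨_; not; if_then_else_)
open import Data.Fin using (Fin; _≟_; _<?_)
open import Data.List using (List; []; _∷_; _++_; length; filter; map; allFin; concatMap; reverse)
open import Data.List.Relation.Unary.Linked using (Linked)
open import Data.List.Relation.Unary.Unique.Propositional using (Unique)
open import Data.List.Relation.Unary.All using (All)
open import Data.List.Membership.Propositional using (_∈_)
open import Data.Product using (_×_; _,_; Σ; ∃; ∃-syntax)
open import Data.Sum using (_⊎_; inj₁; inj₂)
open import Relation.Binary.PropositionalEquality using (_≡_; _≢_)
open import Relation.Nullary using (¬_)
open import Relation.Nullary.Decidable using (⌊_⌋)
open import Data.Empty using (⊥)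

record SimpleGraph (n : ℕ) : Set where
  field
    adj    : Fin n → Fin n → Bool
    sym    : ∀ u v → adj u v ≡ adj v u
    irrefl : ∀ v → adj v v ≡ false

module _ {n : ℕ} (G : SimpleGraph n) where
  open SimpleGraph G

  Adj : Fin n → Fin n → Set
  Adj u v = adj u v ≡ true

  deg : Fin n → ℕ
  deg v = length (filter (λ w → adj v w ≡? true) (allFin n))
    where
      _≡?_ : (a b : Bool) → _
      a ≡? b = Data.Bool._≟_ a b

  -- edges, each listed once as an ordered pair (u , v) with u < v
  edges : List (Fin n × Fin n)
  edges = concatMap (λ u → map (u ,_) (filter (λ v → Data.Bool._≟_ (⌊ u <? v ⌋ ∧ adj u v) true) (allFin n))) (allFin n)

  Element : Set
  Element = Fin n ⊎ (Fin n × Fin n)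

  elements : List Element
  elements = map inj₁ (allFin n) ++ map inj₂ edges

  edgeE : Fin n → Fin n → Element
  edgeE u v = if ⌊ u <? v ⌋ then inj₂ (u , v) else inj₂ (v , u)

  private
    eqF : Fin n → Fin n → Bool
    eqF a b = ⌊ a ≟ b ⌋

  elemAdj : Element → Element → Bool
  elemAdj (inj₁ u) (inj₁ v) = adj u v
  elemAdj (inj₁ u) (inj₂ (a , b)) = eqF u a ∨ eqF u b
  elemAdj (inj₂ (a , b)) (inj₁ u) = eqF u a ∨ eqF u b
  elemAdj (inj₂ (a , b)) (inj₂ (c , d)) =
    not (eqF a c ∧ eqF b d) ∧ (eqF a c ∨ eqF a d ∨ eqF b c ∨ eqF b d)

  dt : Element → ℕ
  dt x = length (filter (λ y → Data.Bool._≟_ (elemAdj x y) true) elements)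

-- m_t(G): sort total degrees non-increasingly, take max{i : d_t(x_i) ≥ i-1}

insertDesc : ℕ → List ℕ → List ℕ
insertDesc x [] = x ∷ []
insertDesc x (y ∷ ys) = if y ≤ᵇ x then x ∷ y ∷ ys else y ∷ insertDesc x ys

sortDesc : List ℕ → List ℕ
sortDesc [] = []
sortDesc (x ∷ xs) = insertDesc x (sortDesc xs)

-- maxIdx k ds: ds = d(x_{k+1}), d(x_{k+2}), ... ; returns the largest
-- index i ≥ k+1 with d(x_i) ≥ i-1 (0 if none)
maxIdx : ℕ → List ℕ → ℕ
maxIdx k [] = 0
maxIdx k (d ∷ ds) = if k ≤ᵇ d then suc k ⊔ maxIdx (suc k) ds else maxIdx (suc k) ds

module _ {n : ℕ} (G : SimpleGraph n) where
  open SimpleGraph G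

  mt : ℕ
  mt = maxIdx 0 (sortDesc (map (dt G) (elements G)))

  TotalDense : Element G → Set
  TotalDense x = mt ∸ 1 ≤ dt G x

  totalDense? : Element G → Bool
  totalDense? x = (mt ∸ 1) ≤ᵇ dt G x

  numTotalDense : ℕ
  numTotalDense = length (filter (λ x → Data.Bool._≟_ (totalDense? x) true) (elements G))

  IsPath : List (Fin n) → Set
  IsPath ws = (ws ≢ []) × Unique ws × Linked (Adj G) ws

  pathEdges : List (Fin n) → List (Fin n × Fin n)
  pathEdges [] = []
  pathEdges (x ∷ []) = []
  pathEdges (x ∷ y ∷ ys) = (x , y) ∷ pathEdges (y ∷ ys)

  pathElements : List (Fin n) → List (Element G)
  pathElements ws = map inj₁ ws ++ map (λ e → edgeE G (Data.Product.proj₁ e) (Data.Product.proj₂ e)) (pathEdges ws)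

  numDenseIn : List (Fin n) → ℕ
  numDenseIn ws = length (filter (λ x → Data.Bool._≟_ (totalDense? x) true) (pathElements ws))

  ℓ : List (Fin n) → ℕ
  ℓ ws = length (pathEdges ws)

  dropLast : List (Fin n) → List (Fin n)
  dropLast [] = []
  dropLast (x ∷ []) = []
  dropLast (x ∷ y ∷ ys) = x ∷ dropLast (y ∷ ys)

  inner : List (Fin n) → List (Fin n)
  inner [] = []
  inner (x ∷ xs) = dropLast xs

  IsTotalDensePath : List (Fin n) → Set
  IsTotalDensePath ws =
    IsPath ws ×
    All (λ w → TotalDense (inj₁ w)) (inner ws) ×
    All (λ e → TotalDense (edgeE G (Data.Product.proj₁ e) (Data.Product.proj₂ e))) (pathEdges ws)

  Connected : Set
  Connected = ∀ u v → ∃[ ws ] (IsPath ws × Σ (List (Fin n)) λ mid → ws ≡ u ∷ mid ++ v ∷ [] ⊎ (u ≡ v × ws ≡ u ∷ []))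

  -- a cycle: a path ⟨w₁,…,w_k⟩ with k ≥ 3 and w_k adjacent to w₁
  Acyclic : Set
  Acyclic = ∀ (w₁ w₂ : Fin n) (mid : List (Fin n)) (wk : Fin n) →
            IsPath (w₁ ∷ w₂ ∷ mid ++ wk ∷ []) → ¬ Adj G wk w₁

  IsTree : Set
  IsTree = Connected × Acyclic

  IsCaterpillar : List (Fin n) → Set
  IsCaterpillar P =
    IsTree × IsPath P ×
    (∀ v → (v ∈ P → 2 ≤ deg G v) × (2 ≤ deg G v → v ∈ P)) ×
    (∀ v → deg G v ≡ 1 → ∃[ w ] (w ∈ P × Adj G v w))

module _ {n : ℕ} where

  _⊑_ : List (Fin n) → List (Fin n) → Set
  R ⊑ S = ∃[ xs ] ∃[ ys ] (S ≡ xs ++ R ++ ys)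

  _≈ₚ_ : List (Fin n) → List (Fin n) → Set
  R ≈ₚ S = (R ≡ S) ⊎ (R ≡ reverse S)

  -- subpath in either orientation (R ⊆ S as subgraphs)
  _⊆ₚ_ : List (Fin n) → List (Fin n) → Set
  R ⊆ₚ S = (R ⊑ S) ⊎ (reverse R ⊑ S)

  data Last : List (Fin n) → Fin n → Set where
    last[] : ∀ x → Last (x ∷ []) x
    last∷  : ∀ {x y ys z} → Last (y ∷ ys) z → Last (x ∷ y ∷ ys) z

  EndsTo : List (Fin n) → List (Fin n) → Set
  EndsTo R S = ∃[ z ] (Last R z × ∃[ zs ] (S ≡ z ∷ zs))

  AdjacentPaths : List (Fin n) → List (Fin n) → Set
  AdjacentPaths R S = EndsTo R S ⊎ EndsTo S R

module _ {n : ℕ} (T : SimpleGraph n) where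
  open SimpleGraph T

  Type1 : Set
  Type1 = ∃[ u ] ∃[ u' ] ∃[ v ]
    ( TotalDense T (inj₁ u) × deg T u ≡ mt T ∸ 2
    × Adj T u u' × deg T u' ≡ 2
    × Adj T u' v × TotalDense T (inj₁ v) × v ≢ u )

  IsMaxTotalDensePath : List (Fin n) → Set
  IsMaxTotalDensePath R =
    IsTotalDensePath T R × 1 ≤ numDenseIn T R ×
    (∀ S → IsTotalDensePath T S → R ⊆ₚ S → S ≈ₚ R)

  Type2 : List (Fin n) → Set
  Type2 P = ∃[ P₁ ] ∃[ P₂ ] ∃[ Q ]
    ( P₁ ⊆ₚ P × P₂ ⊆ₚ P × Q ⊆ₚ P
    × IsMaxTotalDensePath P₁ × IsMaxTotalDensePath P₂ × ¬ (P₁ ≈ₚ P₂)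
    × (∀ R → IsMaxTotalDensePath R → (R ≈ₚ P₁) ⊎ (R ≈ₚ P₂))
    × numDenseIn T P₁ ≡ 3 × numDenseIn T P₂ ≡ 3
    × IsPath T Q × ℓ T Q ≤ 1 × numDenseIn T Q ≡ 0
    × AdjacentPaths Q P₁ × AdjacentPaths Q P₂ )

  PivotBase : List (Fin n) → Set
  PivotBase P = IsCaterpillar T P × 6 ≤ mt T × numTotalDense T ≡ mt T

  IsTotalPivoted : List (Fin n) → Set
  IsTotalPivoted P = PivotBase P × (Type1 ⊎ Type2 P)

{-# OPTIONS --safe #-}
module Submission where

-- A type 1 witness (u, u', v) makes the one-vertex path ⟨v⟩ a maximal total dense
-- path. Indeed, a total dense edge at v would be a total dense element besides u, v
-- and the m − 2 edges at u (each of total degree ≥ d(u) + 1 = m − 1); these are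
-- distinct because u, u', v cannot close a triangle in a tree, giving m + 1 > m
-- total dense elements. In a type 2 caterpillar, however, every maximal total dense
-- path contains three total dense elements, while ⟨v⟩ contains only one.

open import Defs
open import Data.Bool using (true; false; _∧_)
import Data.Bool as Bool
open import Data.Bool.Properties using (T-≡; ∨-zeroʳ)
open import Data.Fin using (Fin; toℕ; _≟_; _<?_)
import Data.Fin.Properties as Fin
open import Data.List using (List; []; _∷_; _++_; length; filter; map; allFin; concatMap; reverse)
open import Data.List.Properties using (length-map; length-filter; length-removeAt′; reverse-involutive)
open import Data.List.Membership.Propositional using (_∈_; _─_; lose)
open import Data.List.Membership.Propositional.Properties
  using (∈-++⁺ˡ; ∈-++⁺ʳ; ∈-map⁺; ∈-map⁻; ∈-allFin; ∈-filter⁺; ∈-filter⁻; ∈-concatMap⁺; ∈-length)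
open import Data.List.Relation.Binary.Subset.Propositional using (_⊆_)
open import Data.List.Relation.Unary.All as All using (All; []; _∷_)
open import Data.List.Relation.Unary.All.Properties as All using ()
open import Data.List.Relation.Unary.AllPairs using ([]; _∷_)
open import Data.List.Relation.Unary.Any using (here; there)
open import Data.List.Relation.Unary.Linked using (Linked; [-]; _∷_)
open import Data.List.Relation.Unary.Unique.Propositional using (Unique)
import Data.List.Relation.Unary.Unique.Propositional.Properties as Unique
open import Data.Nat using (ℕ; zero; suc; _+_; _≤_; _<_; _∸_; s≤s; z≤n)
open import Data.Nat.Properties using (≤⇒≤ᵇ; ≮⇒≥; ≤-refl; ≤-trans; m≤n+m∸n; <-irrefl; <⇒≱; module ≤-Reasoning)
open import Data.Product using (_×_; _,_; ∃-syntax; proj₂)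
open import Data.Sum using (_⊎_; inj₁; inj₂; [_,_]′)
open import Function.Bundles using (Equivalence)
open import Relation.Binary.PropositionalEquality using (_≡_; _≢_; refl; sym; trans; cong; cong₂; subst; ≢-sym)
open import Relation.Nullary using (¬_; Dec; yes; no; contradiction)
open import Relation.Nullary.Decidable using (⌊_⌋; isYes≗does; dec-true; dec-false)

module _ {A : Set} where

  ∈-─⁺ : ∀ {x z : A} {ys} (x∈ys : x ∈ ys) → z ∈ ys → z ≢ x → z ∈ ys ─ x∈ys
  ∈-─⁺ (here refl) (here refl) z≢x = contradiction refl z≢x
  ∈-─⁺ (here refl) (there z∈ys) _ = z∈ys
  ∈-─⁺ (there x∈ys) (here refl) _ = here refl
  ∈-─⁺ (there x∈ys) (there z∈ys) z≢x = there (∈-─⁺ x∈ys z∈ys z≢x)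

  Unique∧⊆⇒length≤ : ∀ {xs ys : List A} → Unique xs → xs ⊆ ys → length xs ≤ length ys
  Unique∧⊆⇒length≤ {[]} _ _ = z≤n
  Unique∧⊆⇒length≤ {x ∷ xs} {ys} (x∉xs ∷ xs!) xs⊆ys =
    subst (suc (length xs) ≤_) (sym (length-removeAt′ ys _))
      (s≤s (Unique∧⊆⇒length≤ xs! λ z∈xs →
        ∈-─⁺ x∈ys (xs⊆ys (there z∈xs)) (≢-sym (All.lookup x∉xs z∈xs))))
    where x∈ys = xs⊆ys (here refl)

⌊⌋-true : ∀ {A : Set} (a? : Dec A) → A → ⌊ a? ⌋ ≡ true
⌊⌋-true a? a = trans (isYes≗does a?) (dec-true a? a)

⌊⌋-false : ∀ {A : Set} (a? : Dec A) → ¬ A → ⌊ a? ⌋ ≡ false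
⌊⌋-false a? ¬a = trans (isYes≗does a?) (dec-false a? ¬a)

m∸1≤1+m∸2 : ∀ m → m ∸ 1 ≤ suc (m ∸ 2)
m∸1≤1+m∸2 zero = z≤n
m∸1≤1+m∸2 (suc zero) = z≤n
m∸1≤1+m∸2 (suc (suc m)) = ≤-refl

≈ₚ-singleton⁻ : ∀ {n} {v : Fin n} {R} → (v ∷ []) ≈ₚ R → R ≡ v ∷ []
≈ₚ-singleton⁻ (inj₁ v≡R) = sym v≡R
≈ₚ-singleton⁻ {R = R} (inj₂ v≡R⁻¹) = trans (sym (reverse-involutive R)) (cong reverse (sym v≡R⁻¹))

module _ {n : ℕ} (G : SimpleGraph n) where
  open SimpleGraph G using (adj; irrefl) renaming (sym to adj-sym)

  Adj-sym : ∀ {a b} → Adj G a b → Adj G b a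
  Adj-sym {a} {b} = trans (adj-sym b a)

  Adj⇒≢ : ∀ {a b} → Adj G a b → a ≢ b
  Adj⇒≢ {a} a~a refl with () ← trans (sym (irrefl a)) a~a

  Acyclic⇒¬triangle : ∀ {u u' v} → Acyclic G → Adj G u u' → Adj G u' v → v ≢ u → ¬ Adj G v u
  Acyclic⇒¬triangle {u} {u'} {v} acyclic u~u' u'~v v≢u =
    acyclic u u' [] v ((λ ()) , unique , u~u' ∷ u'~v ∷ [-])
    where
    unique : Unique (u ∷ u' ∷ v ∷ [])
    unique = (Adj⇒≢ u~u' ∷ ≢-sym v≢u ∷ []) ∷ (Adj⇒≢ u'~v ∷ []) ∷ [] ∷ []

  edgeE-comm : ∀ {a b} → a ≢ b → edgeE G a b ≡ edgeE G b a
  edgeE-comm {a} {b} a≢b with a <? b | b <? a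
  ... | yes a<b | yes b<a = contradiction b<a (Fin.<-asym a<b)
  ... | yes _   | no _    = refl
  ... | no _    | yes _   = refl
  ... | no a≮b  | no b≮a  = contradiction (Fin.≤∧≢⇒< (≮⇒≥ b≮a) a≢b) a≮b

  edgeE-injective : ∀ {a b c d} → edgeE G a b ≡ edgeE G c d → (a ≡ c × b ≡ d) ⊎ (a ≡ d × b ≡ c)
  edgeE-injective {a} {b} {c} {d} eq with a <? b | c <? d | eq
  ... | yes _ | yes _ | refl = inj₁ (refl , refl)
  ... | yes _ | no _  | refl = inj₂ (refl , refl)
  ... | no _  | yes _ | refl = inj₂ (refl , refl)
  ... | no _  | no _  | refl = inj₁ (refl , refl)

  edgeE-injectiveʳ : ∀ {u x y} → edgeE G u x ≡ edgeE G u y → x ≡ y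
  edgeE-injectiveʳ eq with edgeE-injective eq
  ... | inj₁ (_ , x≡y) = x≡y
  ... | inj₂ (u≡y , x≡u) = trans x≡u u≡y

  inj₁≢edgeE : ∀ z a b → inj₁ z ≢ edgeE G a b
  inj₁≢edgeE z a b with a <? b
  ... | yes _ = λ ()
  ... | no _  = λ ()

  vertex∈elements : ∀ v → inj₁ v ∈ elements G
  vertex∈elements v = ∈-++⁺ˡ (∈-map⁺ inj₁ (∈-allFin v))

  ordered-edge∈elements : ∀ {a b} → toℕ a < toℕ b → Adj G a b → inj₂ (a , b) ∈ elements G
  ordered-edge∈elements {a} {b} a<b a~b =
    ∈-++⁺ʳ (map inj₁ (allFin n)) (∈-map⁺ inj₂ (∈-concatMap⁺ edgesFrom (lose (∈-allFin a)
      (∈-map⁺ (a ,_) (∈-filter⁺ (larger a) (∈-allFin b) (cong₂ _∧_ (⌊⌋-true (a <? b) a<b) a~b))))))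
    where
    larger = λ u v → (⌊ u <? v ⌋ ∧ adj u v) Bool.≟ true
    edgesFrom = λ u → map (u ,_) (filter (larger u) (allFin n))

  edgeE∈elements : ∀ {a b} → Adj G a b → edgeE G a b ∈ elements G
  edgeE∈elements {a} {b} a~b with a <? b
  ... | yes a<b = ordered-edge∈elements a<b a~b
  ... | no a≮b  = ordered-edge∈elements (Fin.≤∧≢⇒< (≮⇒≥ a≮b) (≢-sym (Adj⇒≢ a~b))) (Adj-sym a~b)

  edgeE-adj-source : ∀ u w → elemAdj G (edgeE G u w) (inj₁ u) ≡ true
  edgeE-adj-source u w with u <? w
  ... | yes _ rewrite ⌊⌋-true (u ≟ u) refl = refl
  ... | no _  rewrite ⌊⌋-true (u ≟ u) refl = ∨-zeroʳ _

  edgeE-adj-target : ∀ u w → elemAdj G (edgeE G u w) (inj₁ w) ≡ true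
  edgeE-adj-target u w with u <? w
  ... | yes _ rewrite ⌊⌋-true (w ≟ w) refl = ∨-zeroʳ _
  ... | no _  rewrite ⌊⌋-true (w ≟ w) refl = refl

  edgeE-adj-edgeE : ∀ {u w x} → u ≢ w → u ≢ x → w ≢ x → elemAdj G (edgeE G u w) (edgeE G u x) ≡ true
  edgeE-adj-edgeE {u} {w} {x} u≢w u≢x w≢x with u <? w | u <? x
  ... | yes _ | yes _ rewrite ⌊⌋-true (u ≟ u) refl | ⌊⌋-false (w ≟ x) w≢x = refl
  ... | yes _ | no _  rewrite ⌊⌋-true (u ≟ u) refl | ⌊⌋-false (u ≟ x) u≢x = refl
  ... | no _  | yes _
    rewrite ⌊⌋-false (w ≟ u) (≢-sym u≢w) | ⌊⌋-true (u ≟ u) refl | ⌊⌋-false (w ≟ x) w≢x = refl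
  ... | no _  | no _
    rewrite ⌊⌋-false (w ≟ u) (≢-sym u≢w) | ⌊⌋-true (u ≟ u) refl
          | ⌊⌋-false (u ≟ x) u≢x | ⌊⌋-false (w ≟ x) w≢x = refl

  neighbours : Fin n → List (Fin n)
  neighbours u = filter (λ w → adj u w Bool.≟ true) (allFin n)

  neighbours-unique : ∀ u → Unique (neighbours u)
  neighbours-unique u = Unique.filter⁺ (λ w → adj u w Bool.≟ true) (Unique.allFin⁺ n)

  ∈-neighbours⁻ : ∀ {u x} → x ∈ neighbours u → Adj G u x
  ∈-neighbours⁻ {u} x∈ = proj₂ (∈-filter⁻ (λ w → adj u w Bool.≟ true) {xs = allFin n} x∈)

  edgesAt : Fin n → List (Element G)
  edgesAt u = map (edgeE G u) (neighbours u)

  All-edgesAt : ∀ {P : Element G → Set} u → (∀ {x} → Adj G u x → P (edgeE G u x)) → All P (edgesAt u)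
  All-edgesAt u f = All.map⁺ (All.tabulate (λ x∈ → f (∈-neighbours⁻ x∈)))

  edgesAt-unique : ∀ u → Unique (edgesAt u)
  edgesAt-unique u = Unique.map⁺ edgeE-injectiveʳ (neighbours-unique u)

  length-edgesAt : ∀ u → length (edgesAt u) ≡ deg G u
  length-edgesAt u = length-map (edgeE G u) (neighbours u)

  elementNeighbours : Element G → List (Element G)
  elementNeighbours x = filter (λ y → elemAdj G x y Bool.≟ true) (elements G)

  elementBeside : Fin n → Fin n → Fin n → Element G
  elementBeside u w x with x ≟ w
  ... | yes _ = inj₁ u
  ... | no _  = edgeE G u x

  elementBeside-injective : ∀ {u w} → u ≢ w → ∀ {x y} → elementBeside u w x ≡ elementBeside u w y → x ≡ y
  elementBeside-injective {u} {w} u≢w {x} {y} eq with x ≟ w | y ≟ w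
  ... | yes x≡w | yes y≡w = trans x≡w (sym y≡w)
  ... | yes _   | no _    = contradiction eq (inj₁≢edgeE u u y)
  ... | no _    | yes _   = contradiction (sym eq) (inj₁≢edgeE u u x)
  ... | no _    | no _    = edgeE-injectiveʳ eq

  elementBeside-≢ : ∀ {u w} → u ≢ w → ∀ x → inj₁ w ≢ elementBeside u w x
  elementBeside-≢ {u} {w} u≢w x with x ≟ w
  ... | yes _ = λ { refl → u≢w refl }
  ... | no _  = inj₁≢edgeE w u x

  elementBeside-∈ : ∀ {u w x} → Adj G u w → Adj G u x →
                    elementBeside u w x ∈ elementNeighbours (edgeE G u w)
  elementBeside-∈ {u} {w} {x} u~w u~x with x ≟ w
  ... | yes _   = ∈-filter⁺ _ (vertex∈elements u) (edgeE-adj-source u w)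
  ... | no x≢w  =
    ∈-filter⁺ _ (edgeE∈elements u~x) (edgeE-adj-edgeE (Adj⇒≢ u~w) (Adj⇒≢ u~x) (≢-sym x≢w))

  -- The edge uw is adjacent to w and, for each neighbour x of u, to ux (to u itself when x = w).
  deg<dt-edgeE : ∀ {u w} → Adj G u w → deg G u < dt G (edgeE G u w)
  deg<dt-edgeE {u} {w} u~w =
    subst (λ k → suc k ≤ dt G (edgeE G u w)) (length-map (elementBeside u w) (neighbours u))
      (Unique∧⊆⇒length≤ unique beside⊆)
    where
    u≢w = Adj⇒≢ u~w
    unique : Unique (inj₁ w ∷ map (elementBeside u w) (neighbours u))
    unique = All.map⁺ (All.universal (elementBeside-≢ u≢w) _)
           ∷ Unique.map⁺ (elementBeside-injective u≢w) (neighbours-unique u)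
    beside⊆ : inj₁ w ∷ map (elementBeside u w) (neighbours u) ⊆ elementNeighbours (edgeE G u w)
    beside⊆ (here refl) = ∈-filter⁺ _ (vertex∈elements w) (edgeE-adj-target u w)
    beside⊆ (there z∈) with x , x∈ , refl ← ∈-map⁻ (elementBeside u w) z∈ =
      elementBeside-∈ u~w (∈-neighbours⁻ x∈)

  isTotalDense : ∀ x → Dec (totalDense? G x ≡ true)
  isTotalDense x = totalDense? G x Bool.≟ true

  length≤numTotalDense : ∀ {L} → Unique L → All (_∈ elements G) L → All (TotalDense G) L →
                         length L ≤ numTotalDense G
  length≤numTotalDense L! L⊆elements L-dense = Unique∧⊆⇒length≤ L! λ x∈L →
    ∈-filter⁺ _ (All.lookup L⊆elements x∈L) (Equivalence.to T-≡ (≤⇒≤ᵇ (All.lookup L-dense x∈L)))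

  mt<numTotalDense : ∀ {u v x} →
    TotalDense G (inj₁ u) → deg G u ≡ mt G ∸ 2 →
    TotalDense G (inj₁ v) → v ≢ u → ¬ Adj G u v →
    Adj G v x → TotalDense G (edgeE G v x) →
    mt G < numTotalDense G
  mt<numTotalDense {u} {v} {x} u-dense deg-u v-dense v≢u u≁v v~x vx-dense = begin-strict
    mt G                  ≤⟨ m≤n+m∸n (mt G) 2 ⟩
    2 + (mt G ∸ 2)        <⟨ ≤-refl ⟩
    3 + (mt G ∸ 2)        ≡⟨ cong (3 +_) (sym (trans (length-edgesAt u) deg-u)) ⟩
    length denseElements  ≤⟨ length≤numTotalDense unique inElements allDense ⟩
    numTotalDense G       ∎
    where
    open ≤-Reasoning
    denseElements = inj₁ u ∷ inj₁ v ∷ edgeE G v x ∷ edgesAt u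
    vx∉edgesAt : ∀ {y} → Adj G u y → edgeE G v x ≢ edgeE G u y
    vx∉edgesAt u~y eq with edgeE-injective eq
    ... | inj₁ (v≡u , _) = v≢u v≡u
    ... | inj₂ (refl , _) = u≁v u~y
    unique : Unique denseElements
    unique = ((λ { refl → v≢u refl }) ∷ inj₁≢edgeE u v x ∷ All-edgesAt u (λ _ → inj₁≢edgeE u u _))
           ∷ (inj₁≢edgeE v v x ∷ All-edgesAt u (λ _ → inj₁≢edgeE v u _))
           ∷ All-edgesAt u vx∉edgesAt
           ∷ edgesAt-unique u
    inElements : All (_∈ elements G) denseElements
    inElements = vertex∈elements u ∷ vertex∈elements v ∷ edgeE∈elements v~x
               ∷ All-edgesAt u edgeE∈elements
    allDense : All (TotalDense G) denseElements
    allDense = u-dense ∷ v-dense ∷ vx-dense ∷ All-edgesAt u λ {y} u~y →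
      ≤-trans (m∸1≤1+m∸2 (mt G)) (subst (λ k → suc k ≤ dt G (edgeE G u y)) deg-u (deg<dt-edgeE u~y))

  ∈-pathEdges-out : ∀ xs {v y : Fin n} ys → (v , y) ∈ pathEdges G (xs ++ v ∷ y ∷ ys)
  ∈-pathEdges-out [] ys = here refl
  ∈-pathEdges-out (x ∷ []) ys = there (here refl)
  ∈-pathEdges-out (x ∷ x' ∷ xs) ys = there (∈-pathEdges-out (x' ∷ xs) ys)

  ∈-pathEdges-in : ∀ x xs {v : Fin n} ys → ∃[ a ] (a , v) ∈ pathEdges G (x ∷ xs ++ v ∷ ys)
  ∈-pathEdges-in x [] ys = x , here refl
  ∈-pathEdges-in x (x' ∷ xs) ys with a , a∈ ← ∈-pathEdges-in x' xs ys = a , there a∈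

  Linked⇒pathEdges-Adj : ∀ {S a b} → Linked (Adj G) S → (a , b) ∈ pathEdges G S → Adj G a b
  Linked⇒pathEdges-Adj (a~b ∷ _) (here refl) = a~b
  Linked⇒pathEdges-Adj (_ ∷ linked) (there e∈) = Linked⇒pathEdges-Adj linked e∈

  TotalDensePath⇒singleton⊎denseEdge : ∀ {S v} xs ys → IsTotalDensePath G S → S ≡ xs ++ v ∷ ys →
    S ≡ v ∷ [] ⊎ ∃[ x ] (Adj G v x × TotalDense G (edgeE G v x))
  TotalDensePath⇒singleton⊎denseEdge [] [] _ refl = inj₁ refl
  TotalDensePath⇒singleton⊎denseEdge xs (y ∷ ys) ((_ , _ , linked) , _ , dense) refl =
    inj₂ (y , Linked⇒pathEdges-Adj linked e∈ , All.lookup dense e∈)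
    where e∈ = ∈-pathEdges-out xs ys
  TotalDensePath⇒singleton⊎denseEdge (x ∷ xs) [] ((_ , _ , linked) , _ , dense) refl
    with a , e∈ ← ∈-pathEdges-in x xs [] =
    let a~v = Linked⇒pathEdges-Adj linked e∈ in
    inj₂ (a , Adj-sym a~v , subst (TotalDense G) (edgeE-comm (Adj⇒≢ a~v)) (All.lookup dense e∈))

  isolated⇒IsMaxTotalDensePath : ∀ {v} → TotalDense G (inj₁ v) →
    (∀ {x} → Adj G v x → ¬ TotalDense G (edgeE G v x)) → IsMaxTotalDensePath G (v ∷ [])
  isolated⇒IsMaxTotalDensePath {v} v-dense isolated =
    singleton , dense , λ _ S-dense → [ maximal S-dense , maximal S-dense ]′
    where
    singleton : IsTotalDensePath G (v ∷ [])
    singleton = ((λ ()) , [] ∷ [] , [-]) , [] , []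
    dense : 1 ≤ numDenseIn G (v ∷ [])
    dense = ∈-length (∈-filter⁺ isTotalDense {xs = inj₁ v ∷ []} (here refl)
                                (Equivalence.to T-≡ (≤⇒≤ᵇ v-dense)))
    maximal : ∀ {S} → IsTotalDensePath G S → (v ∷ []) ⊑ S → S ≈ₚ (v ∷ [])
    maximal S-dense (xs , ys , S≡) with TotalDensePath⇒singleton⊎denseEdge xs ys S-dense S≡
    ... | inj₁ S≡v = inj₁ S≡v
    ... | inj₂ (x , v~x , vx-dense) = contradiction vx-dense (isolated v~x)

  ≈ₚ-singleton⇒numDenseIn≤1 : ∀ {v R} → (v ∷ []) ≈ₚ R → numDenseIn G R ≤ 1
  ≈ₚ-singleton⇒numDenseIn≤1 {v} v≈R with refl ← ≈ₚ-singleton⁻ v≈R =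
    length-filter isTotalDense (inj₁ v ∷ [])

  Type1⇒IsMaxTotalDensePath-singleton : Acyclic G → numTotalDense G ≡ mt G → Type1 G →
    ∃[ v ] IsMaxTotalDensePath G (v ∷ [])
  Type1⇒IsMaxTotalDensePath-singleton acyclic count
    (u , _ , v , u-dense , deg-u , u~u' , _ , u'~v , v-dense , v≢u) =
    v , isolated⇒IsMaxTotalDensePath v-dense λ v~x vx-dense →
      <-irrefl (sym count) (mt<numTotalDense u-dense deg-u v-dense v≢u u≁v v~x vx-dense)
    where
    u≁v : ¬ Adj G u v
    u≁v u~v = Acyclic⇒¬triangle acyclic u~u' u'~v v≢u (Adj-sym u~v)

  IsMaxTotalDensePath-singleton⇒¬Type2 : ∀ {v} P → IsMaxTotalDensePath G (v ∷ []) → ¬ Type2 G P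
  IsMaxTotalDensePath-singleton⇒¬Type2 {v} P max
    (_ , _ , _ , _ , _ , _ , _ , _ , _ , onlyP₁P₂ , three₁ , three₂ , _) =
    [ notThree three₁ , notThree three₂ ]′ (onlyP₁P₂ (v ∷ []) max)
    where
    notThree : ∀ {R} → numDenseIn G R ≡ 3 → ¬ (v ∷ []) ≈ₚ R
    notThree three v≈R =
      <⇒≱ (s≤s (s≤s z≤n)) (subst (_≤ 1) three (≈ₚ-singleton⇒numDenseIn≤1 v≈R))

lemma3 : ∀ {n : ℕ} (T : SimpleGraph n) (P : List (Fin n)) →
    IsTotalPivoted T P →
    (Type1 T ⊎ Type2 T P) × ¬ (Type1 T × Type2 T P)
lemma3 T P (((tree , _) , _ , count) , type) = type , λ (type1 , type2) →
  let _ , max = Type1⇒IsMaxTotalDensePath-singleton T (proj₂ tree) count type1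
  in IsMaxTotalDensePath-singleton⇒¬Type2 T P max type2
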